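{- Consider graphs without isolated vertices and without $K_2$ components. For every positive integer $m\neq 1,3$, there is no such graph $G$ such that $D_k^t(G)\cong P_m$ for some integer $k$.
   Context: $P_m$ is the path on $m$ vertices. A total dominating set (TDS) of a graph without isolated vertices is a vertex set $S$ such that every vertex is adjacent to a vertex of $S$. For a positive integer $k$, $D_k^t(G)$ is the graph whose vertices are the TDSs of $G$ of cardinality at most $k$, two being adjacent if and only if one is obtained from the other by adding or deleting a single vertex. -}

module Defs where

open import Data.Nat using (ℕ; suc; _≤_)
open import Data.Bool using (Bool; true)
open import Data.Fin using (Fin; toℕ)
open import Data.Fin.Subset using (Subset; _∈_; _∉_; ∣_∣; inside)
open import Data.Vec using (_[_]≔_)
open import Data.Product using (Σ; ∃; _×_)
open import Data.Sum using (_⊎_)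
open import Relation.Binary.PropositionalEquality using (_≡_)
open import Relation.Nullary using (¬_)

record Graph (n : ℕ) : Set where
  field
    adj     : Fin n → Fin n → Bool
    adj-sym : ∀ u v → adj u v ≡ adj v u
    irrefl  : ∀ v → ¬ (adj v v ≡ true)

open Graph public

Adj : ∀ {n} → Graph n → Fin n → Fin n → Set
Adj G u v = adj G u v ≡ true

NoIsolated : ∀ {n} → Graph n → Set
NoIsolated G = ∀ v → ∃ λ u → Adj G v u

NoK2Component : ∀ {n} → Graph n → Set
NoK2Component G =
  ∀ u v → Adj G u v →
  ¬ ((∀ w → Adj G u w → w ≡ v) × (∀ w → Adj G v w → w ≡ u))

IsTDS : ∀ {n} → Graph n → Subset n → Set
IsTDS G S = ∀ v → ∃ λ u → u ∈ S × Adj G v u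

IsDkVertex : ∀ {n} → Graph n → ℕ → Subset n → Set
IsDkVertex G k S = IsTDS G S × ∣ S ∣ ≤ k

AddOne : ∀ {n} → Subset n → Subset n → Set
AddOne S T = ∃ λ x → x ∉ S × T ≡ S [ x ]≔ inside

DAdj : ∀ {n} → Subset n → Subset n → Set
DAdj S T = AddOne S T ⊎ AddOne T S

PathAdj : ∀ {m} → Fin m → Fin m → Set
PathAdj i j = toℕ j ≡ suc (toℕ i) ⊎ toℕ i ≡ suc (toℕ j)

record DktIsoPath {n} (G : Graph n) (k m : ℕ) : Set where
  field
    f          : Fin m → Subset n
    f-vertex   : ∀ i → IsDkVertex G k (f i)
    f-injective : ∀ i j → f i ≡ f j → i ≡ j
    f-surjective : ∀ S → IsDkVertex G k S → ∃ λ i → f i ≡ S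
    f-adj      : ∀ i j → PathAdj i j → DAdj (f i) (f j)
    f-adj⁻     : ∀ i j → DAdj (f i) (f j) → PathAdj i j

-- Suppose f : P_m ≅ D_k^t(G) with m = 2 or m ≥ 4.  Along a path edge the
-- size of f changes by exactly one.  Let S₀ = f i₀ have minimum size γ; a
-- path neighbour of i₀ is S₀ ⊕ x₀, every S₀ ⊕ x is one, and a path vertex
-- has at most two neighbours, so one or two vertices lie outside S₀.
--   Case I, V ∖ S₀ = {x₀}: n = γ + 1 and sizes alternate between γ and
--   γ + 1 = n, the latter only for V.  For m ≥ 4 two of a₀ … a₃ equal V;
--   for m = 2, V ∖ {z} for a suitable z ≠ x₀ is a third vertex.
--   Case II, V ∖ S₀ = {x₀, y₀}: n = γ + 2, and k = γ + 1 since V would close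
--   a 4-cycle.  For m = 2, S₀ and S₀ ⊕ x₀, S₀ ⊕ y₀ are three vertices; for
--   m ≥ 4 the end vertex a₀ cannot have size γ, and if it has size γ + 1 the
--   sets f a₀ … f a₃ yield the configuration ruled out by the
--   private-neighbour lemma (GraphFacts.PrivateNeighbours).

module Submission where

open import Defs
open import Data.Bool using (true) renaming (_≟_ to _≟ᵇ_)
open import Data.Empty using (⊥; ⊥-elim)
open import Data.Fin using (Fin; zero; suc; _≟_; punchOut; inject₁)
open import Data.Fin.Properties
  using (toℕ-injective; toℕ-inject₁; any?; all?; ¬∀⟶∃¬; punchOut-injective; injective⇒≤)
open import Data.Fin.Subset using (Subset; _∈_; _∉_; ∣_∣; inside; outside; ⊤)
open import Data.Fin.Subset.Properties
  using (_∈?_; ∈⊤; ⊆⊤; ⊆-antisym; ∣⊤∣≡n; ∣p∣≤n; ∣p∣≡n⇒p≡⊤)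
open import Data.Nat using (ℕ; zero; suc; _≤_; _<_; s≤s)
import Data.Nat.Properties as ℕ
open import Data.Product using (∃; _×_; _,_; proj₁; proj₂)
open import Data.Sum using (_⊎_; inj₁; inj₂; [_,_])
open import Data.Vec using (_∷_; lookup; _[_]≔_; here; there)
open import Data.Vec.Properties
  using ([]=-injective; []=⇒lookup; lookup⇒[]=; lookup∘updateAt′;
         []≔-updates; []≔-minimal; []≔-idempotent; []≔-lookup; []≔-commutes)
open import Relation.Binary.PropositionalEquality
  using (_≡_; _≢_; refl; sym; trans; cong; subst; module ≡-Reasoning)
open import Relation.Nullary using (¬_; Dec; yes; no)
open import Relation.Nullary.Decidable using (_×-dec_; ¬?; decidable-stable)
open import Relation.Unary using (Decidable)

-- Adding and removing one element of a finite subset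

infixl 6 _⊕_ _⊖_

_⊕_ : ∀ {n} → Subset n → Fin n → Subset n
S ⊕ x = S [ x ]≔ inside

_⊖_ : ∀ {n} → Subset n → Fin n → Subset n
S ⊖ x = S [ x ]≔ outside

module _ {n} {S : Subset n} where

  ¬∉⇒∈ : ∀ {u} → ¬ (u ∉ S) → u ∈ S
  ¬∉⇒∈ {u} = decidable-stable (u ∈? S)

  ∉⇒lookup : ∀ {x} → x ∉ S → lookup S x ≡ outside
  ∉⇒lookup {x} x∉S with lookup S x in eq
  ... | inside  = ⊥-elim (x∉S (lookup⇒[]= x S eq))
  ... | outside = refl

  ∈-⊕ : ∀ x → x ∈ S ⊕ x
  ∈-⊕ x = []≔-updates S x

  ⊕-⊇ : ∀ {u} x → u ∈ S → u ∈ S ⊕ x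
  ⊕-⊇ {u} x u∈S with u ≟ x
  ... | yes refl = ∈-⊕ x
  ... | no  u≢x  = []≔-minimal S u x u≢x u∈S

  ∈⊕⁻ : ∀ {u} x → u ∈ S ⊕ x → u ≡ x ⊎ u ∈ S
  ∈⊕⁻ {u} x u∈ with u ≟ x
  ... | yes u≡x = inj₁ u≡x
  ... | no  u≢x = inj₂ (lookup⇒[]= u S
                   (trans (sym (lookup∘updateAt′ u x u≢x S)) ([]=⇒lookup u∈)))

  ∉-⊖ : ∀ x → x ∉ S ⊖ x
  ∉-⊖ x x∈ with []=-injective x∈ ([]≔-updates S x)
  ... | ()

  ⊖-⊇ : ∀ {u} x → u ∈ S → u ≢ x → u ∈ S ⊖ x
  ⊖-⊇ {u} x u∈S u≢x = []≔-minimal S u x u≢x u∈S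

  ⊖⊕-restore : ∀ {w} → w ∈ S → (S ⊖ w) ⊕ w ≡ S
  ⊖⊕-restore {w} w∈S = begin
    (S ⊖ w) ⊕ w            ≡⟨ []≔-idempotent S w ⟩
    S [ w ]≔ inside        ≡⟨ cong (S [ w ]≔_) (sym ([]=⇒lookup w∈S)) ⟩
    S [ w ]≔ lookup S w    ≡⟨ []≔-lookup S w ⟩
    S                      ∎
    where open ≡-Reasoning

  ⊕⊖-restore : ∀ {w} → w ∉ S → (S ⊕ w) ⊖ w ≡ S
  ⊕⊖-restore {w} w∉S = begin
    (S ⊕ w) ⊖ w            ≡⟨ []≔-idempotent S w ⟩
    S [ w ]≔ outside       ≡⟨ cong (S [ w ]≔_) (sym (∉⇒lookup w∉S)) ⟩
    S [ w ]≔ lookup S w    ≡⟨ []≔-lookup S w ⟩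
    S                      ∎
    where open ≡-Reasoning

  ⊕-new : ∀ {x} → x ∉ S → S ⊕ x ≢ S
  ⊕-new {x} x∉S e = x∉S (subst (x ∈_) e (∈-⊕ x))

  ⊕-distinct : ∀ {x y} → x ∉ S → S ⊕ x ≡ S ⊕ y → x ≡ y
  ⊕-distinct {x} {y} x∉S e with ∈⊕⁻ y (subst (x ∈_) e (∈-⊕ x))
  ... | inj₁ x≡y = x≡y
  ... | inj₂ x∈S = ⊥-elim (x∉S x∈S)

⊕-cancel : ∀ {n} {S T : Subset n} {w} → w ∉ S → w ∉ T → S ⊕ w ≡ T ⊕ w → S ≡ T
⊕-cancel {S = S} {T} {w} w∉S w∉T e =
  trans (sym (⊕⊖-restore w∉S)) (trans (cong (_⊖ w) e) (⊕⊖-restore w∉T))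

card-⊕ : ∀ {n} (S : Subset n) {x} → x ∉ S → ∣ S ⊕ x ∣ ≡ suc ∣ S ∣
card-⊕ (inside  ∷ S) {zero}  x∉ = ⊥-elim (x∉ here)
card-⊕ (outside ∷ S) {zero}  x∉ = refl
card-⊕ (inside  ∷ S) {suc x} x∉ = cong suc (card-⊕ S (λ p → x∉ (there p)))
card-⊕ (outside ∷ S) {suc x} x∉ = card-⊕ S (λ p → x∉ (there p))

card-⊖ : ∀ {n} (S : Subset n) {w} → w ∈ S → suc ∣ S ⊖ w ∣ ≡ ∣ S ∣
card-⊖ S {w} w∈S = trans (sym (card-⊕ (S ⊖ w) (∉-⊖ w))) (cong ∣_∣ (⊖⊕-restore w∈S))

all∈⇒full : ∀ {n} {S : Subset n} → (∀ u → u ∈ S) → ∣ S ∣ ≡ n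
all∈⇒full {n} all∈ = trans (cong ∣_∣ (⊆-antisym ⊆⊤ (λ {u} _ → all∈ u))) (∣⊤∣≡n n)

∃∉ : ∀ {n} (S : Subset n) → ∣ S ∣ < n → ∃ λ x → x ∉ S
∃∉ {n} S small with all? (_∈? S)
... | yes all∈ = ⊥-elim (ℕ.<-irrefl (all∈⇒full all∈) small)
... | no ¬all∈ = ¬∀⟶∃¬ n (_∈ S) (_∈? S) ¬all∈

full⇒all∈ : ∀ {n} {S : Subset n} → ∣ S ∣ ≡ n → ∀ u → u ∈ S
full⇒all∈ full u = subst (u ∈_) (sym (∣p∣≡n⇒p≡⊤ full)) ∈⊤

-- Counting on Fin n

injective⇒onto : ∀ {n} (g : Fin n → Fin n) → (∀ {a b} → g a ≡ g b → a ≡ b) →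
                 ∀ c → ∃ λ s → g s ≡ c
injective⇒onto {suc n} g g-inj c with any? (λ s → g s ≟ c)
... | yes hit = hit
... | no miss = ⊥-elim (ℕ.<-irrefl refl (injective⇒≤ squeezed-inj))
  where
    squeezed : Fin (suc n) → Fin n
    squeezed s = punchOut {i = c} (λ e → miss (s , sym e))
    squeezed-inj : ∀ {a b} → squeezed a ≡ squeezed b → a ≡ b
    squeezed-inj {a} {b} e =
      g-inj (punchOut-injective (λ e′ → miss (a , sym e′)) (λ e′ → miss (b , sym e′)) e)

argmin : ∀ {m} (h : Fin (suc m) → ℕ) → ∃ λ i → ∀ j → h i ≤ h j
argmin {zero}  h = zero , λ { zero → ℕ.≤-refl }
argmin {suc m} h with argmin (λ j → h (suc j))
... | i , min with ℕ.≤-total (h zero) (h (suc i))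
...   | inj₁ h0≤ = zero , λ { zero → ℕ.≤-refl ; (suc j) → ℕ.≤-trans h0≤ (min j) }
...   | inj₂ ≤h0 = suc i , λ { zero → ≤h0 ; (suc j) → min j }

-- The path P_m

Consecutive : ℕ → ℕ → Set
Consecutive a b = b ≡ suc a ⊎ a ≡ suc b

consecutive-atMost2 : ∀ {a b c d} → Consecutive a b → Consecutive a c → Consecutive a d →
                      b ≡ c ⊎ b ≡ d ⊎ c ≡ d
consecutive-atMost2 (inj₁ refl) (inj₁ refl) _           = inj₁ refl
consecutive-atMost2 (inj₂ refl) (inj₂ refl) _           = inj₁ refl
consecutive-atMost2 (inj₁ refl) (inj₂ refl) (inj₁ refl) = inj₂ (inj₁ refl)
consecutive-atMost2 (inj₁ refl) (inj₂ refl) (inj₂ refl) = inj₂ (inj₂ refl)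
consecutive-atMost2 (inj₂ refl) (inj₁ refl) (inj₁ refl) = inj₂ (inj₂ refl)
consecutive-atMost2 (inj₂ refl) (inj₁ refl) (inj₂ refl) = inj₂ (inj₁ refl)

consecutive-noSquare : ∀ {a b c d} → Consecutive a b → Consecutive a c →
                       Consecutive d b → Consecutive d c → b ≢ c → a ≡ d
consecutive-noSquare (inj₁ refl) (inj₁ refl) _ _ b≢c = ⊥-elim (b≢c refl)
consecutive-noSquare (inj₂ refl) (inj₂ refl) _ _ b≢c = ⊥-elim (b≢c refl)
consecutive-noSquare (inj₁ refl) (inj₂ refl) (inj₁ refl) _           _ = refl
consecutive-noSquare (inj₁ refl) (inj₂ refl) (inj₂ refl) (inj₁ ())   _
consecutive-noSquare (inj₁ refl) (inj₂ refl) (inj₂ refl) (inj₂ ())   _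
consecutive-noSquare (inj₂ refl) (inj₁ refl) _           (inj₁ refl) _ = refl
consecutive-noSquare (inj₂ refl) (inj₁ refl) (inj₁ refl) (inj₂ ())   _
consecutive-noSquare (inj₂ refl) (inj₁ refl) (inj₂ refl) (inj₂ ())   _

module _ {m : ℕ} where

  pathAdj-sym : ∀ {i j : Fin m} → PathAdj i j → PathAdj j i
  pathAdj-sym (inj₁ e) = inj₂ e
  pathAdj-sym (inj₂ e) = inj₁ e

  path-degree≤2 : ∀ {i a b c : Fin m} → PathAdj i a → PathAdj i b → PathAdj i c →
                  a ≢ b → a ≢ c → b ≢ c → ⊥
  path-degree≤2 ia ib ic a≢b a≢c b≢c with consecutive-atMost2 ia ib ic
  ... | inj₁ e        = a≢b (toℕ-injective e)
  ... | inj₂ (inj₁ e) = a≢c (toℕ-injective e)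
  ... | inj₂ (inj₂ e) = b≢c (toℕ-injective e)

  path-noSquare : ∀ {a b c d : Fin m} → PathAdj a b → PathAdj a c →
                  PathAdj d b → PathAdj d c → b ≢ c → a ≡ d
  path-noSquare ab ac db dc b≢c =
    toℕ-injective (consecutive-noSquare ab ac db dc (λ e → b≢c (toℕ-injective e)))

path-neighbour : ∀ {m} (i : Fin (suc (suc m))) → ∃ λ j → PathAdj i j
path-neighbour zero    = suc zero , inj₁ refl
path-neighbour (suc i) = inject₁ i , inj₂ (cong suc (sym (toℕ-inject₁ i)))

NoThreeDistinct : ℕ → Set
NoThreeDistinct m = ∀ (a b c : Fin m) → a ≢ b → a ≢ c → b ≢ c → ⊥

P₂-noThreeDistinct : NoThreeDistinct 2
P₂-noThreeDistinct zero       zero       _          a≢b _   _   = a≢b refl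
P₂-noThreeDistinct (suc zero) (suc zero) _          a≢b _   _   = a≢b refl
P₂-noThreeDistinct zero       (suc zero) zero       _   a≢c _   = a≢c refl
P₂-noThreeDistinct zero       (suc zero) (suc zero) _   _   b≢c = b≢c refl
P₂-noThreeDistinct (suc zero) zero       zero       _   _   b≢c = b≢c refl
P₂-noThreeDistinct (suc zero) zero       (suc zero) _   a≢c _   = a≢c refl

record PathStart (m : ℕ) : Set where
  field
    a₀ a₁ a₂ a₃ : Fin m
    a₀a₁  : PathAdj a₀ a₁
    a₁a₂  : PathAdj a₁ a₂
    a₂a₃  : PathAdj a₂ a₃
    a₀≢a₂ : a₀ ≢ a₂
    a₁≢a₃ : a₁ ≢ a₃
    a₀-end : ∀ j → PathAdj a₀ j → j ≡ a₁

pathStart : ∀ m → PathStart (suc (suc (suc (suc m))))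
pathStart m = record
  { a₀ = zero ; a₁ = suc zero ; a₂ = suc (suc zero) ; a₃ = suc (suc (suc zero))
  ; a₀a₁ = inj₁ refl ; a₁a₂ = inj₁ refl ; a₂a₃ = inj₁ refl
  ; a₀≢a₂ = λ () ; a₁≢a₃ = λ ()
  ; a₀-end = λ { j (inj₁ e) → toℕ-injective e ; j (inj₂ ()) } }

-- Domination in a graph

-- Every vertex has a neighbour satisfying P.  For P = (_∈ S) this is
-- literally "S is a total dominating set"; for P = (_≢ z) it says that
-- V ∖ {z} is one, i.e. z is not the only neighbour of any vertex.
Dominates : ∀ {n} → Graph n → (Fin n → Set) → Set
Dominates G P = ∀ v → ∃ λ u → P u × Adj G v u

NbrsWithin : ∀ {n} → Graph n → Fin n → Fin n → Fin n → Set
NbrsWithin G v a b = ∀ c → Adj G v c → c ≡ a ⊎ c ≡ b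

Leaf : ∀ {n} → Graph n → Fin n → Fin n → Set
Leaf G l s = ∀ c → Adj G l c → c ≡ s

module GraphFacts {n} (G : Graph n) where

  adj-sym′ : ∀ {a b} → Adj G a b → Adj G b a
  adj-sym′ {a} {b} ab = trans (adj-sym G b a) ab

  adj-≢ : ∀ {a b} → Adj G a b → a ≢ b
  adj-≢ {a} aa refl = irrefl G a aa

  adj? : ∀ a b → Dec (Adj G a b)
  adj? a b = adj G a b ≟ᵇ true

  dominates-mono : ∀ {P Q : Fin n → Set} → (∀ {u} → P u → Q u) → Dominates G P → Dominates G Q
  dominates-mono P⇒Q dom v with dom v
  ... | u , Pu , vu = u , P⇒Q Pu , vu

  undominated : ∀ {P : Fin n → Set} → Decidable P → ¬ Dominates G P →
                ∃ λ v → ∀ u → Adj G v u → ¬ P u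
  undominated {P} P? ¬dom
    with ¬∀⟶∃¬ n (λ v → ∃ λ u → P u × Adj G v u)
                 (λ v → any? (λ u → P? u ×-dec adj? v u)) ¬dom
  ... | v , ¬v = v , λ u vu Pu → ¬v (u , Pu , vu)

  dominates? : ∀ {P : Fin n → Set} → Decidable P → Dec (Dominates G P)
  dominates? P? = all? (λ v → any? (λ u → P? u ×-dec adj? v u))

  dominates-or-leaf : ∀ z → Dominates G (_≢ z) ⊎ ∃ λ l → Leaf G l z
  dominates-or-leaf z with dominates? (λ u → ¬? (u ≟ z))
  ... | yes dom = inj₁ dom
  ... | no ¬dom with undominated (λ u → ¬? (u ≟ z)) ¬dom
  ...   | l , noNbr = inj₂ (l , λ c lc → decidable-stable (c ≟ z) (noNbr c lc))

  otherNeighbour : ∀ {a l} → ¬ Leaf G a l → ∃ λ b → b ≢ l × Adj G a b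
  otherNeighbour {a} {l} ¬leaf with any? (λ b → ¬? (b ≟ l) ×-dec adj? a b)
  ... | yes found = found
  ... | no none = ⊥-elim (¬leaf (λ c ac → decidable-stable (c ≟ l) (λ c≢l → none (c , c≢l , ac))))

  module _ (noIso : NoIsolated G) (noK2 : NoK2Component G) where

    -- Without K₂ components, no leaf has a leaf hanging at it.
    leaf-dominates : ∀ {l s} → Leaf G l s → Dominates G (_≢ l)
    leaf-dominates {l} {s} l-leaf with dominates-or-leaf l
    ... | inj₁ dom = dom
    ... | inj₂ (v , v-leaf) with noIso v
    ...   | r , vr = ⊥-elim (noK2 l s ls (l-leaf , s-leaf))
      where
        vl : Adj G v l
        vl = subst (Adj G v) (v-leaf r vr) vr
        v≡s : v ≡ s
        v≡s = l-leaf v (adj-sym′ vl)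
        ls : Adj G l s
        ls = subst (Adj G l) v≡s (adj-sym′ vl)
        s-leaf : Leaf G s l
        s-leaf = subst (λ t → Leaf G t l) v≡s v-leaf

    -- Every vertex x has a vertex z ≠ x such that V ∖ {z} is a total
    -- dominating set: take a neighbour a of x, or else a leaf hanging at a;
    -- if that leaf is x itself, repeat with a second neighbour b of a.
    nonSupport≢ : ∀ x → ∃ λ z → z ≢ x × Dominates G (_≢ z)
    nonSupport≢ x with noIso x
    ... | a , xa with dominates-or-leaf a
    ...   | inj₁ dom = a , (λ a≡x → adj-≢ xa (sym a≡x)) , dom
    ...   | inj₂ (l , l-leaf) with l ≟ x
    ...     | no l≢x = l , l≢x , leaf-dominates l-leaf
    ...     | yes refl with otherNeighbour (λ a-leaf → noK2 l a xa (l-leaf , a-leaf))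
    ...       | b , b≢l , ab = second-neighbour
      where
        second-neighbour : ∃ λ z → z ≢ l × Dominates G (_≢ z)
        second-neighbour with dominates-or-leaf b
        ... | inj₁ dom = b , b≢l , dom
        ... | inj₂ (l′ , l′-leaf) = l′ , l′≢l , leaf-dominates l′-leaf
          where
            l′≢l : l′ ≢ l
            l′≢l refl = adj-≢ ab (l′-leaf a xa)

  -- Choosing such an r = u(w) for each w gives an
  -- injection of the n − 2 vertices w ∉ {x,y} into V whose image U has
  -- N(u(w)) = {w} or {x,w}; so at most two vertices lie outside U, and a
  -- short case analysis around y and x exhibits a third one.
  module PrivateNeighbours
    {x y z : Fin n} (x≢y : x ≢ y) (y≢z : y ≢ z) (z≢x : z ≢ x)
    (avoid-xy : Dominates G (λ u → u ≢ x × u ≢ y))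
    (avoid-yz : Dominates G (λ u → u ≢ y × u ≢ z))
    (privateNbr : ∀ w → w ≢ x → w ≢ y → ∃ λ r → NbrsWithin G r x w)
    where

    W : Fin n → Set
    W w = w ≢ x × w ≢ y

    u : Fin n → Fin n
    u w with w ≟ x | w ≟ y
    ... | no w≢x | no w≢y = proj₁ (privateNbr w w≢x w≢y)
    ... | _      | _      = w

    u-within : ∀ {w} → W w → NbrsWithin G (u w) x w
    u-within {w} (w≢x , w≢y) with w ≟ x | w ≟ y
    ... | yes w≡x | _       = ⊥-elim (w≢x w≡x)
    ... | no _    | yes w≡y = ⊥-elim (w≢y w≡y)
    ... | no w≢x′ | no w≢y′ = proj₂ (privateNbr w w≢x′ w≢y′)

    -- u(w) is adjacent to w (it needs a neighbour outside {x,y}) ...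
    u-adj : ∀ {w} → W w → Adj G (u w) w
    u-adj {w} Ww with avoid-xy (u w)
    ... | c , (c≢x , _) , uc with u-within Ww c uc
    ...   | inj₁ c≡x = ⊥-elim (c≢x c≡x)
    ...   | inj₂ c≡w = subst (Adj G (u w)) c≡w uc

    u-injective : ∀ {w w′} → W w → W w′ → u w ≡ u w′ → w ≡ w′
    u-injective {w} Ww Ww′ e with u-within Ww′ w (subst (λ r → Adj G r w) e (u-adj Ww))
    ... | inj₁ w≡x  = ⊥-elim (proj₁ Ww w≡x)
    ... | inj₂ w≡w′ = w≡w′

    InU : Fin n → Set
    InU r = ∃ λ w → W w × u w ≡ r

    InU? : ∀ r → Dec (InU r)
    InU? r with any? (λ w → (¬? (w ≟ x) ×-dec ¬? (w ≟ y)) ×-dec (u w ≟ r))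
    ... | yes (w , Ww , e) = yes (w , Ww , e)
    ... | no none          = no λ { (w , Ww , e) → none (w , Ww , e) }

    owner : ∀ {r c} → InU r → Adj G r c → c ≢ x → u c ≡ r
    owner (w , Ww , refl) rc c≢x with u-within Ww _ rc
    ... | inj₁ c≡x = ⊥-elim (c≢x c≡x)
    ... | inj₂ refl = refl

    U-¬adj-y : ∀ {r} → InU r → ¬ Adj G r y
    U-¬adj-y (w , Ww , refl) uy with u-within Ww y uy
    ... | inj₁ y≡x = x≢y (sym y≡x)
    ... | inj₂ y≡w = proj₂ Ww (sym y≡w)

    -- |U| = n − 2: no three distinct vertices lie outside U.  Indeed,
    -- sending x ↦ a, y ↦ b and w ↦ u(w) would be an injective self-map
    -- of V missing c.
    module _ {a b : Fin n} (a≢b : a ≢ b) (a∉U : ¬ InU a) (b∉U : ¬ InU b) where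

      relabel : ∀ v → Dec (v ≡ x) → Dec (v ≡ y) → Fin n
      relabel v (yes _) _       = a
      relabel v (no _)  (yes _) = b
      relabel v (no _)  (no _)  = u v

      g : Fin n → Fin n
      g v = relabel v (v ≟ x) (v ≟ y)

      data Relabelled (v : Fin n) : Fin n → Set where
        at-x : v ≡ x → Relabelled v a
        at-y : v ≡ y → Relabelled v b
        at-W : W v → Relabelled v (u v)

      relabelled : ∀ v → Relabelled v (g v)
      relabelled v = cases (v ≟ x) (v ≟ y)
        where
          cases : ∀ dx dy → Relabelled v (relabel v dx dy)
          cases (yes v≡x) _         = at-x v≡x
          cases (no _)    (yes v≡y) = at-y v≡y
          cases (no v≢x)  (no v≢y)  = at-W (v≢x , v≢y)

      -- g is injective: it is so on each of its three pieces, and the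
      -- pieces have disjoint images because a, b ∉ U.
      g-injective : ∀ {v v′} → g v ≡ g v′ → v ≡ v′
      g-injective {v} {v′} = compare (relabelled v) (relabelled v′)
        where
          compare : ∀ {p q} → Relabelled v p → Relabelled v′ q → p ≡ q → v ≡ v′
          compare (at-x v≡x) (at-x v′≡x) _ = trans v≡x (sym v′≡x)
          compare (at-y v≡y) (at-y v′≡y) _ = trans v≡y (sym v′≡y)
          compare (at-W Wv)  (at-W Wv′)  e = u-injective Wv Wv′ e
          compare (at-x _)   (at-y _)    e = ⊥-elim (a≢b e)
          compare (at-y _)   (at-x _)    e = ⊥-elim (a≢b (sym e))
          compare (at-x _)   (at-W Wv′)  e = ⊥-elim (a∉U (v′ , Wv′ , sym e))
          compare (at-y _)   (at-W Wv′)  e = ⊥-elim (b∉U (v′ , Wv′ , sym e))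
          compare (at-W Wv)  (at-x _)    e = ⊥-elim (a∉U (v , Wv , e))
          compare (at-W Wv)  (at-y _)    e = ⊥-elim (b∉U (v , Wv , e))

      atMostTwoOutside : ∀ {c} → a ≢ c → b ≢ c → ¬ InU c → ⊥
      atMostTwoOutside {c} a≢c b≢c c∉U with injective⇒onto g g-injective c
      ... | s , gs≡c = hit (relabelled s) gs≡c
        where
          hit : ∀ {p} → Relabelled s p → p ≢ c
          hit (at-x _)  = a≢c
          hit (at-y _)  = b≢c
          hit (at-W Ws) = λ e → c∉U (s , Ws , e)

    module _ {t s : Fin n} (Wt : W t) (yt : Adj G y t) (Ws : W s) (ts : Adj G t s) where

      t∉U : ¬ InU t
      t∉U t∈U = U-¬adj-y t∈U (adj-sym′ yt)

      t≢s : t ≢ s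
      t≢s = adj-≢ ts

      y≢t : y ≢ t
      y≢t y≡t = proj₂ Wt (sym y≡t)

      y≢s : y ≢ s
      y≢s y≡s = proj₂ Ws (sym y≡s)

      -- If y ∈ U then y = u(t), so s cannot be u(t) as well.
      y∈U⇒s∉U : InU y → ¬ InU s
      y∈U⇒s∉U y∈U s∈U =
        y≢s (trans (sym (owner y∈U yt (proj₁ Wt))) (owner s∈U (adj-sym′ ts) (proj₁ Wt)))

      -- x ∈ U, for otherwise x, t and either y or s are three vertices outside U.
      x∈U : InU x
      x∈U = decidable-stable (InU? x) x∉U⇒⊥
        where
          x∉U⇒⊥ : ¬ InU x → ⊥
          x∉U⇒⊥ x∉U with InU? y
          ... | yes y∈U = atMostTwoOutside (λ e → proj₁ Wt (sym e)) x∉U t∉U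
                            (λ e → proj₁ Ws (sym e)) t≢s (y∈U⇒s∉U y∈U)
          ... | no  y∉U = atMostTwoOutside x≢y x∉U y∉U (λ e → proj₁ Wt (sym e)) y≢t t∉U

      -- Write x = u(ws).  Then x is a leaf at ws, and ws = u(z), so N(ws) ⊆ {x,z}.
      module _ {ws : Fin n} (Wws : W ws) (uws≡x : u ws ≡ x) where

        Wz : W z
        Wz = z≢x , λ z≡y → y≢z (sym z≡y)

        x-leaf : Leaf G x ws
        x-leaf c xc with u-within Wws c (subst (λ r → Adj G r c) (sym uws≡x) xc)
        ... | inj₁ c≡x  = ⊥-elim (adj-≢ xc (sym c≡x))
        ... | inj₂ c≡ws = c≡ws

        uz≡ws : u z ≡ ws
        uz≡ws with avoid-yz (u z)
        ... | r , (_ , r≢z) , uzr with u-within Wz r uzr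
        ...   | inj₁ refl = x-leaf (u z) (adj-sym′ uzr)
        ...   | inj₂ r≡z  = ⊥-elim (r≢z r≡z)

        ws-within : NbrsWithin G ws x z
        ws-within = subst (λ r → NbrsWithin G r x z) uz≡ws (u-within Wz)

        u≡x⇒≡ws : ∀ {w} → W w → u w ≡ x → w ≡ ws
        u≡x⇒≡ws Ww e = u-injective Ww Wws (trans e (sym uws≡x))

        -- Case y ∉ U: then s = u(t) and u(s) = x, so s = ws and t ∈ N(ws)
        -- forces t = z; now y's neighbour outside {y,z} is a third vertex
        -- outside U besides y and t.
        y∉U⇒⊥ : ¬ InU y → ⊥
        y∉U⇒⊥ y∉U with avoid-yz y
        ... | r , (r≢y , r≢z) , yr =
          atMostTwoOutside y≢t y∉U t∉U (λ e → r≢y (sym e)) t≢r (λ r∈U → U-¬adj-y r∈U (adj-sym′ yr))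
          where
            s∈U : InU s
            s∈U = decidable-stable (InU? s) (atMostTwoOutside y≢t y∉U t∉U y≢s t≢s)
            s-within : NbrsWithin G s x t
            s-within = subst (λ q → NbrsWithin G q x t) (owner s∈U (adj-sym′ ts) (proj₁ Wt)) (u-within Wt)
            us≡x : u s ≡ x
            us≡x with s-within (u s) (adj-sym′ (u-adj Ws))
            ... | inj₁ us≡x = us≡x
            ... | inj₂ us≡t = ⊥-elim (t∉U (s , Ws , us≡t))
            t≡z : t ≡ z
            t≡z with ws-within t (subst (λ q → Adj G q t) (u≡x⇒≡ws Ws us≡x) (adj-sym′ ts))
            ... | inj₁ t≡x = ⊥-elim (proj₁ Wt t≡x)
            ... | inj₂ t≡z = t≡z
            t≢r : t ≢ r
            t≢r t≡r = r≢z (trans (sym t≡r) t≡z)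

        -- Case y ∈ U: then y = u(t) and s ∉ U; t's neighbour outside {y,z}
        -- must be s, so s ≠ z.  But u(s) ∈ W and u(u(s)) ∈ N(u(s)) ⊆ {x,s}
        -- force u(s) = ws = u(z), i.e. s = z.
        y∈U⇒⊥ : InU y → ⊥
        y∈U⇒⊥ y∈U with avoid-yz t
        ... | p , (p≢y , p≢z) , tp = p≢z (trans p≡s s≡z)
          where
            s∉U : ¬ InU s
            s∉U = y∈U⇒s∉U y∈U
            ut≡y : u t ≡ y
            ut≡y = owner y∈U yt (proj₁ Wt)
            p≡s : p ≡ s
            p≡s = decidable-stable (p ≟ s) λ p≢s →
              atMostTwoOutside t≢s (t∉U) s∉U (adj-≢ tp) (λ e → p≢s (sym e))
                (λ p∈U → p≢y (trans (sym (owner p∈U (adj-sym′ tp) (proj₁ Wt))) ut≡y))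
            Wus : W (u s)
            Wus = (λ us≡x → s∉U (z , Wz , trans uz≡ws (sym (u≡x⇒≡ws Ws us≡x))))
                , (λ us≡y → t≢s (sym (u-injective Ws Wt (trans us≡y (sym ut≡y)))))
            s≡z : s ≡ z
            s≡z with u-within Ws (u (u s)) (adj-sym′ (u-adj Wus))
            ... | inj₁ uus≡x = u-injective Ws Wz (trans (u≡x⇒≡ws Wus uus≡x) (sym uz≡ws))
            ... | inj₂ uus≡s = ⊥-elim (s∉U (u s , Wus , uus≡s))

    impossible : ⊥
    impossible with avoid-xy y
    ... | t , Wt , yt with avoid-xy t
    ...   | s , Ws , ts with x∈U Wt yt Ws ts
    ...     | ws , Wws , uws≡x with InU? y
    ...       | yes y∈U = y∈U⇒⊥ Wt yt Ws ts Wws uws≡x y∈U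
    ...       | no  y∉U = y∉U⇒⊥ Wt yt Ws ts Wws uws≡x y∉U

-- An isomorphism D_k^t(G) ≅ P_m with m ≥ 2

module PathIsomorphism {n} {G : Graph n} (noIso : NoIsolated G) (noK2 : NoK2Component G)
                       {k m : ℕ} (iso : DktIsoPath G k (suc (suc m))) where
  open DktIsoPath iso
  open GraphFacts G

  sz : Fin (suc (suc m)) → ℕ
  sz i = ∣ f i ∣

  isTDS : ∀ i → IsTDS G (f i)
  isTDS i = proj₁ (f-vertex i)

  sz≤k : ∀ i → sz i ≤ k
  sz≤k i = proj₂ (f-vertex i)

  card-add : ∀ {S T : Subset n} → AddOne S T → ∣ T ∣ ≡ suc ∣ S ∣
  card-add {S} (x , x∉S , refl) = card-⊕ S x∉S

  equalSize-nonadjacent : ∀ {i j} → PathAdj i j → sz i ≡ sz j → ⊥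
  equalSize-nonadjacent {i} {j} ij e with f-adj i j ij
  ... | inj₁ up   = ℕ.1+n≢n (trans (sym (card-add up)) (sym e))
  ... | inj₂ down = ℕ.1+n≢n (trans (sym (card-add down)) e)

  stepDown : ∀ {i j} → PathAdj i j → sz i ≡ suc (sz j) → AddOne (f j) (f i)
  stepDown {i} {j} ij e with f-adj i j ij
  ... | inj₁ up   = ⊥-elim (ℕ.m≢1+n+m (sz j) {1} (trans (card-add up) (cong suc e)))
  ... | inj₂ down = down

  vertexOf : ∀ {S} → IsTDS G S → ∣ S ∣ ≤ k → ∃ λ j → f j ≡ S
  vertexOf {S} tds small = f-surjective S (tds , small)

  grow : ∀ i {x} → x ∉ f i → suc (sz i) ≤ k → ∃ λ j → f j ≡ f i ⊕ x × PathAdj i j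
  grow i {x} x∉ small
    with vertexOf (dominates-mono (⊕-⊇ x) (isTDS i)) (subst (_≤ k) (sym (card-⊕ (f i) x∉)) small)
  ... | j , fj = j , fj , f-adj⁻ i j (inj₁ (x , x∉ , fj))

  shrink : ∀ i {w} → w ∈ f i → IsTDS G (f i ⊖ w) → ∃ λ j → f j ≡ f i ⊖ w × PathAdj i j
  shrink i {w} w∈ tds
    with vertexOf tds (ℕ.≤-trans (ℕ.n≤1+n _) (subst (_≤ k) (sym (card-⊖ (f i) w∈)) (sz≤k i)))
  ... | j , fj = j , fj , pathAdj-sym (f-adj⁻ j i (inj₁ (w , w∉fj , fi≡fj⊕w)))
    where
      w∉fj : w ∉ f j
      w∉fj = subst (w ∉_) (sym fj) (∉-⊖ w)
      fi≡fj⊕w : f i ≡ f j ⊕ w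
      fi≡fj⊕w = trans (sym (⊖⊕-restore w∈)) (cong (_⊕ w) (sym fj))

  grown-distinct : ∀ {i j j′ x y} → x ∉ f i → f j ≡ f i ⊕ x → f j′ ≡ f i ⊕ y → j ≡ j′ → x ≡ y
  grown-distinct x∉ fj fj′ refl = ⊕-distinct x∉ (trans (sym fj) fj′)

  minimum-neighbour : ∀ {i₀ j} → (∀ j → sz i₀ ≤ sz j) → PathAdj i₀ j → AddOne (f i₀) (f j)
  minimum-neighbour {i₀} {j} min i₀j with f-adj i₀ j i₀j
  ... | inj₁ up   = up
  ... | inj₂ down = ⊥-elim (ℕ.<-irrefl refl (ℕ.≤-trans (ℕ.≤-reflexive (sym (card-add down))) (min j)))

  module FromMinimum {i₀ : Fin (suc (suc m))} (γ-min : ∀ j → sz i₀ ≤ sz j)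
                     {j₀ x₀} (i₀j₀ : PathAdj i₀ j₀) (x₀∉S₀ : x₀ ∉ f i₀) (fj₀ : f j₀ ≡ f i₀ ⊕ x₀)
                     where
    γ : ℕ
    γ = sz i₀

    S₀ : Subset n
    S₀ = f i₀

    sz-j₀ : sz j₀ ≡ suc γ
    sz-j₀ = trans (cong ∣_∣ fj₀) (card-⊕ S₀ x₀∉S₀)

    γ<k : suc γ ≤ k
    γ<k = subst (_≤ k) sz-j₀ (sz≤k j₀)

    i₀≢j₀ : i₀ ≢ j₀
    i₀≢j₀ i₀≡j₀ = ⊕-new x₀∉S₀ (trans (sym fj₀) (cong f (sym i₀≡j₀)))

    module TwoLevels (bounded : ∀ j → sz j ≤ suc γ) where

      level : ∀ j → sz j ≡ γ ⊎ sz j ≡ suc γ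
      level j with ℕ.m≤n⇒m<n∨m≡n (bounded j)
      ... | inj₁ (s≤s below) = inj₁ (ℕ.≤-antisym below (γ-min j))
      ... | inj₂ top         = inj₂ top

      opposite : ∀ {i j} → PathAdj i j →
                 (sz i ≡ γ × sz j ≡ suc γ) ⊎ (sz i ≡ suc γ × sz j ≡ γ)
      opposite {i} {j} ij with level i | level j
      ... | inj₁ i-low  | inj₂ j-high = inj₁ (i-low , j-high)
      ... | inj₂ i-high | inj₁ j-low  = inj₂ (i-high , j-low)
      ... | inj₁ i-low  | inj₁ j-low  = ⊥-elim (equalSize-nonadjacent ij (trans i-low (sym j-low)))
      ... | inj₂ i-high | inj₂ j-high = ⊥-elim (equalSize-nonadjacent ij (trans i-high (sym j-high)))

      alternate : ∀ {a b c} → PathAdj a b → PathAdj b c → sz a ≡ sz c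
      alternate ab bc with opposite ab | opposite bc
      ... | inj₁ (a-low , _)  | inj₂ (_ , c-low)  = trans a-low (sym c-low)
      ... | inj₂ (a-high , _) | inj₁ (_ , c-high) = trans a-high (sym c-high)
      ... | inj₁ (_ , b-high) | inj₁ (b-low , _)  = ⊥-elim (ℕ.1+n≢n (trans (sym b-high) b-low))
      ... | inj₂ (_ , b-low)  | inj₂ (b-high , _) = ⊥-elim (ℕ.1+n≢n (trans (sym b-high) b-low))

    -- Case I: x₀ is the only vertex outside S₀.  Then f j₀ = V, so n = γ + 1,
    -- the sets of size γ + 1 are all equal to V, and sizes alternate.
    module OneMissing (only : ∀ x → x ∉ S₀ → x ≡ x₀) where

      all∈fj₀ : ∀ u → u ∈ f j₀
      all∈fj₀ u = subst (u ∈_) (sym fj₀) (u∈S₀⊕x₀ (u ≟ x₀))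
        where
          u∈S₀⊕x₀ : Dec (u ≡ x₀) → u ∈ S₀ ⊕ x₀
          u∈S₀⊕x₀ (yes refl)  = ∈-⊕ x₀
          u∈S₀⊕x₀ (no u≢x₀)   = ⊕-⊇ x₀ (¬∉⇒∈ (λ u∉S₀ → u≢x₀ (only u u∉S₀)))

      n≡ : suc γ ≡ n
      n≡ = trans (sym sz-j₀) (all∈⇒full all∈fj₀)

      open TwoLevels (λ j → subst (sz j ≤_) (sym n≡) (∣p∣≤n (f j)))

      top-unique : ∀ {i j} → sz i ≡ suc γ → sz j ≡ suc γ → i ≡ j
      top-unique {i} {j} i-top j-top =
        f-injective i j (trans (∣p∣≡n⇒p≡⊤ (trans i-top n≡)) (sym (∣p∣≡n⇒p≡⊤ (trans j-top n≡))))

      -- m = 2: besides S₀ and V, the set V ∖ {z} for a vertex z ≠ x₀ that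
      -- dominates no leaf is a third vertex of D_k^t(G).
      short : NoThreeDistinct (suc (suc m)) → ⊥
      short noThree with nonSupport≢ noIso noK2 x₀
      ... | z , z≢x₀ , dom with vertexOf {⊤ ⊖ z} (dominates-mono (λ u≢z → ⊖-⊇ z ∈⊤ u≢z) dom) T-small
        where
          T-small : ∣ ⊤ ⊖ z ∣ ≤ k
          T-small = ℕ.≤-trans (∣p∣≤n (⊤ ⊖ z)) (subst (_≤ k) n≡ γ<k)
      ...   | jz , fjz = noThree i₀ j₀ jz i₀≢j₀ i₀≢jz j₀≢jz
        where
          i₀≢jz : i₀ ≢ jz
          i₀≢jz refl = x₀∉S₀ (subst (x₀ ∈_) (sym fjz) (⊖-⊇ z ∈⊤ (λ x₀≡z → z≢x₀ (sym x₀≡z))))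
          j₀≢jz : j₀ ≢ jz
          j₀≢jz refl = ∉-⊖ z (subst (z ∈_) fjz (all∈fj₀ z))

      -- m ≥ 4: either a₀, a₂ or a₁, a₃ both have size γ + 1, i.e. both are V.
      long : PathStart (suc (suc m)) → ⊥
      long start = twoTops (opposite a₀a₁)
        where
          open PathStart start
          twoTops : (sz a₀ ≡ γ × sz a₁ ≡ suc γ) ⊎ (sz a₀ ≡ suc γ × sz a₁ ≡ γ) → ⊥
          twoTops (inj₂ (a₀-top , _)) =
            a₀≢a₂ (top-unique a₀-top (trans (sym (alternate a₀a₁ a₁a₂)) a₀-top))
          twoTops (inj₁ (_ , a₁-top)) =
            a₁≢a₃ (top-unique a₁-top (trans (sym (alternate a₁a₂ a₂a₃)) a₁-top))

    module TwoMissing {y₀} (y₀∉S₀ : y₀ ∉ S₀) (y₀≢x₀ : y₀ ≢ x₀) where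

      iy-data : ∃ λ iy → f iy ≡ S₀ ⊕ y₀ × PathAdj i₀ iy
      iy-data = grow i₀ y₀∉S₀ γ<k

      iy : Fin (suc (suc m))
      iy = proj₁ iy-data

      fiy : f iy ≡ S₀ ⊕ y₀
      fiy = proj₁ (proj₂ iy-data)

      i₀iy : PathAdj i₀ iy
      i₀iy = proj₂ (proj₂ iy-data)

      j₀≢iy : j₀ ≢ iy
      j₀≢iy j₀≡iy = y₀≢x₀ (sym (grown-distinct x₀∉S₀ fj₀ fiy j₀≡iy))

      i₀≢iy : i₀ ≢ iy
      i₀≢iy i₀≡iy = ⊕-new y₀∉S₀ (trans (sym fiy) (cong f (sym i₀≡iy)))

      -- A third vertex outside S₀ would give i₀ a third path neighbour.
      onlyTwo : ∀ x → x ∉ S₀ → x ≡ x₀ ⊎ x ≡ y₀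
      onlyTwo x x∉S₀ with x ≟ x₀ | x ≟ y₀
      ... | yes x≡x₀ | _        = inj₁ x≡x₀
      ... | no _     | yes x≡y₀ = inj₂ x≡y₀
      ... | no x≢x₀  | no x≢y₀ with grow i₀ x∉S₀ γ<k
      ...   | j , fj , i₀j = ⊥-elim (path-degree≤2 i₀j i₀j₀ i₀iy
                               (λ e → x≢x₀ (grown-distinct x∉S₀ fj fj₀ e))
                               (λ e → x≢y₀ (grown-distinct x∉S₀ fj fiy e)) j₀≢iy)

      y₀∉fj₀ : y₀ ∉ f j₀
      y₀∉fj₀ y₀∈ with ∈⊕⁻ x₀ (subst (y₀ ∈_) fj₀ y₀∈)
      ... | inj₁ y₀≡x₀ = y₀≢x₀ y₀≡x₀
      ... | inj₂ y₀∈S₀ = y₀∉S₀ y₀∈S₀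

      all∈V : ∀ u → u ∈ f j₀ ⊕ y₀
      all∈V u with u ∈? S₀
      ... | yes u∈S₀ = ⊕-⊇ y₀ (subst (u ∈_) (sym fj₀) (⊕-⊇ x₀ u∈S₀))
      ... | no u∉S₀ with onlyTwo u u∉S₀
      ...   | inj₁ refl = ⊕-⊇ y₀ (subst (u ∈_) (sym fj₀) (∈-⊕ x₀))
      ...   | inj₂ refl = ∈-⊕ y₀

      n≡ : suc (suc γ) ≡ n
      n≡ = trans (cong suc (sym sz-j₀)) (trans (sym (card-⊕ (f j₀) y₀∉fj₀)) (all∈⇒full all∈V))

      -- k = γ + 1: otherwise V is a vertex of D_k^t(G) adjacent to both
      -- j₀ and iy, closing the 4-cycle i₀ j₀ V iy in the path.
      k≡ : k ≡ suc γ
      k≡ = ℕ.≤-antisym (ℕ.≤-pred (ℕ.≰⇒> V-not-vertex)) γ<k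
        where
          V-not-vertex : ¬ (suc (suc γ) ≤ k)
          V-not-vertex big with vertexOf (dominates-mono (⊕-⊇ y₀) (isTDS j₀))
                                   (subst (_≤ k) (sym (trans (all∈⇒full all∈V) (sym n≡))) big)
          ... | jV , fjV = x₀∉S₀ (subst (x₀ ∈_) (sym (trans (cong f i₀≡jV) fjV)) (⊕-⊇ y₀ x₀∈fj₀))
            where
              x₀∈fj₀ : x₀ ∈ f j₀
              x₀∈fj₀ = subst (x₀ ∈_) (sym fj₀) (∈-⊕ x₀)
              x₀∉fiy : x₀ ∉ f iy
              x₀∉fiy x₀∈ with ∈⊕⁻ y₀ (subst (x₀ ∈_) fiy x₀∈)
              ... | inj₁ x₀≡y₀ = y₀≢x₀ (sym x₀≡y₀)
              ... | inj₂ x₀∈S₀ = x₀∉S₀ x₀∈S₀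
              fjV≡fiy⊕x₀ : f jV ≡ f iy ⊕ x₀
              fjV≡fiy⊕x₀ = begin
                f jV               ≡⟨ fjV ⟩
                f j₀ ⊕ y₀          ≡⟨ cong (_⊕ y₀) fj₀ ⟩
                S₀ ⊕ x₀ ⊕ y₀       ≡⟨ []≔-commutes S₀ x₀ y₀ (λ e → y₀≢x₀ (sym e)) ⟩
                S₀ ⊕ y₀ ⊕ x₀       ≡⟨ cong (_⊕ x₀) (sym fiy) ⟩
                f iy ⊕ x₀          ∎
                where open ≡-Reasoning
              i₀≡jV : i₀ ≡ jV
              i₀≡jV = path-noSquare i₀j₀ i₀iy
                        (pathAdj-sym (f-adj⁻ j₀ jV (inj₁ (y₀ , y₀∉fj₀ , fjV))))
                        (pathAdj-sym (f-adj⁻ iy jV (inj₁ (x₀ , x₀∉fiy , fjV≡fiy⊕x₀))))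
                        j₀≢iy

      open TwoLevels (λ j → subst (sz j ≤_) k≡ (sz≤k j))

      short : NoThreeDistinct (suc (suc m)) → ⊥
      short noThree = noThree i₀ j₀ iy i₀≢j₀ i₀≢iy j₀≢iy

      γ+1<n : suc γ < n
      γ+1<n = subst (suc γ <_) n≡ ℕ.≤-refl

      singleMissing : ∀ {i x} → sz i ≡ suc γ → x ∉ f i → ∀ u → u ∉ f i → u ≡ x
      singleMissing {i} {x} i-top x∉ u u∉ with ∈⊕⁻ x (full⇒all∈ fi⊕x-full u)
        where
          fi⊕x-full : ∣ f i ⊕ x ∣ ≡ n
          fi⊕x-full = trans (card-⊕ (f i) x∉) (trans (cong suc i-top) n≡)
      ... | inj₁ u≡x = u≡x
      ... | inj₂ u∈  = ⊥-elim (u∉ u∈)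

      module LongPath (start : PathStart (suc (suc m))) where
        open PathStart start

        -- If |f a₀| = γ = n − 2, adding either missing vertex gives two
        -- different neighbours of the end vertex a₀.
        lowEnd : sz a₀ ≡ γ → ⊥
        lowEnd a₀-low with ∃∉ (f a₀) (subst (_< n) (sym a₀-low) (ℕ.<-trans ℕ.≤-refl γ+1<n))
        ... | a , a∉ with ∃∉ (f a₀ ⊕ a) (subst (_< n) (sym (trans (card-⊕ (f a₀) a∉) (cong suc a₀-low))) γ+1<n)
        ...   | b , b∉ with grow a₀ a∉ room | grow a₀ (λ b∈ → b∉ (⊕-⊇ a b∈)) room
          where
            room : suc (sz a₀) ≤ k
            room = subst (λ s → suc s ≤ k) (sym a₀-low) γ<k
        ...     | ja , fja , a₀ja | jb , fjb , a₀jb =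
          b∉ (subst (λ q → q ∈ f a₀ ⊕ a) a≡b (∈-⊕ a))
          where
            a≡b : a ≡ b
            a≡b = grown-distinct a∉ fja fjb (trans (a₀-end ja a₀ja) (sym (a₀-end jb a₀jb)))

        -- If |f a₀| = n − 1, say f a₀ = V ∖ {x}, then sizes force
        -- f a₀ = f a₁ ⊕ y, f a₂ = f a₁ ⊕ w and f a₂ = f a₃ ⊕ z, and the
        -- configuration of the private-neighbour lemma appears.
        module HighEnd {x y w z : Fin n}
          (x∉₀ : x ∉ f a₀) (only₀ : ∀ u → u ∉ f a₀ → u ≡ x)
          (y∉₁ : y ∉ f a₁) (e₁ : f a₀ ≡ f a₁ ⊕ y)
          (w∉₁ : w ∉ f a₁) (e₂ : f a₂ ≡ f a₁ ⊕ w)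
          (z∉₃ : z ∉ f a₃) (e₃ : f a₂ ≡ f a₃ ⊕ z) where

          y∈₀ : y ∈ f a₀
          y∈₀ = subst (y ∈_) (sym e₁) (∈-⊕ y)

          x∉₁ : x ∉ f a₁
          x∉₁ x∈₁ = x∉₀ (subst (x ∈_) (sym e₁) (⊕-⊇ y x∈₁))

          x≢y : x ≢ y
          x≢y x≡y = x∉₀ (subst (_∈ f a₀) (sym x≡y) y∈₀)

          -- w = y would make f a₂ = f a₀; so w ∉ f a₀, i.e. w = x.
          w≢y : w ≢ y
          w≢y w≡y = a₀≢a₂ (f-injective a₀ a₂ (trans e₁ (sym (subst (λ q → f a₂ ≡ f a₁ ⊕ q) w≡y e₂))))

          w≡x : w ≡ x
          w≡x = only₀ w w∉₀
            where
              w∉₀ : w ∉ f a₀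
              w∉₀ w∈₀ with ∈⊕⁻ y (subst (w ∈_) e₁ w∈₀)
              ... | inj₁ w≡y = w≢y w≡y
              ... | inj₂ w∈₁ = w∉₁ w∈₁

          y∉₂ : y ∉ f a₂
          y∉₂ y∈₂ with ∈⊕⁻ w (subst (y ∈_) e₂ y∈₂)
          ... | inj₁ y≡w = w≢y (sym y≡w)
          ... | inj₂ y∈₁ = y∉₁ y∈₁

          y∉₃ : y ∉ f a₃
          y∉₃ y∈₃ = y∉₂ (subst (y ∈_) (sym e₃) (⊕-⊇ z y∈₃))

          y≢z : y ≢ z
          y≢z y≡z = y∉₂ (subst (_∈ f a₂) (sym y≡z) (subst (z ∈_) (sym e₃) (∈-⊕ z)))

          -- z = x would give f a₁ ⊕ x = f a₂ = f a₃ ⊕ x, so a₁ = a₃.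
          z≢x : z ≢ x
          z≢x z≡x = a₁≢a₃ (f-injective a₁ a₃ (⊕-cancel x∉₁ (subst (_∉ f a₃) z≡x z∉₃) fa₁⊕x≡fa₃⊕x))
            where
              fa₁⊕x≡fa₃⊕x : f a₁ ⊕ x ≡ f a₃ ⊕ x
              fa₁⊕x≡fa₃⊕x = begin
                f a₁ ⊕ x    ≡⟨ cong (f a₁ ⊕_) (sym w≡x) ⟩
                f a₁ ⊕ w    ≡⟨ sym e₂ ⟩
                f a₂        ≡⟨ e₃ ⟩
                f a₃ ⊕ z    ≡⟨ cong (f a₃ ⊕_) z≡x ⟩
                f a₃ ⊕ x    ∎
                where open ≡-Reasoning

          avoid-xy : Dominates G (λ u → u ≢ x × u ≢ y)
          avoid-xy = dominates-mono (λ {u} u∈₁ → (λ u≡x → x∉₁ (subst (_∈ f a₁) u≡x u∈₁))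
                                              , (λ u≡y → y∉₁ (subst (_∈ f a₁) u≡y u∈₁)))
                                    (isTDS a₁)

          avoid-yz : Dominates G (λ u → u ≢ y × u ≢ z)
          avoid-yz = dominates-mono (λ {u} u∈₃ → (λ u≡y → y∉₃ (subst (_∈ f a₃) u≡y u∈₃))
                                              , (λ u≡z → z∉₃ (subst (_∈ f a₃) u≡z u∈₃)))
                                    (isTDS a₃)

          -- For v ∉ {x,y}, f a₀ ⊖ v is not a TDS: it would be a path
          -- neighbour of the end vertex a₀ other than a₁ (it contains y).
          -- So some vertex has all its neighbours in {x,v}.
          privateNbr : ∀ v → v ≢ x → v ≢ y → ∃ λ r → NbrsWithin G r x v
          privateNbr v v≢x v≢y with dominates? (_∈? (f a₀ ⊖ v))
          ... | yes tds with shrink a₀ (¬∉⇒∈ (λ v∉₀ → v≢x (only₀ v v∉₀))) tds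
          ...   | j , fj , a₀j = ⊥-elim (
                  y∉₁ (subst (y ∈_) (trans (sym fj) (cong f (a₀-end j a₀j)))
                                    (⊖-⊇ v y∈₀ (λ y≡v → v≢y (sym y≡v)))))
          privateNbr v v≢x v≢y | no ¬tds with undominated (_∈? (f a₀ ⊖ v)) ¬tds
          ...   | r , r-out = r , within
            where
              within : NbrsWithin G r x v
              within c rc with c ≟ v
              ... | yes c≡v = inj₂ c≡v
              ... | no  c≢v = inj₁ (only₀ c (λ c∈₀ → r-out c rc (⊖-⊇ v c∈₀ c≢v)))

          impossible : ⊥
          impossible = PrivateNeighbours.impossible x≢y y≢z z≢x avoid-xy avoid-yz privateNbr

        long : ⊥
        long with opposite a₀a₁
        ... | inj₁ (a₀-low , _) = lowEnd a₀-low
        ... | inj₂ (a₀-high , a₁-low)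
            with ∃∉ (f a₀) (subst (_< n) (sym a₀-high) γ+1<n)
               | stepDown a₀a₁ (trans a₀-high (cong suc (sym a₁-low)))
               | stepDown (pathAdj-sym a₁a₂) (trans a₂-high (cong suc (sym a₁-low)))
               | stepDown a₂a₃ (trans a₂-high (cong suc (sym a₃-low)))
          where
            a₂-high : sz a₂ ≡ suc γ
            a₂-high = trans (sym (alternate a₀a₁ a₁a₂)) a₀-high
            a₃-low : sz a₃ ≡ γ
            a₃-low = trans (sym (alternate a₁a₂ a₂a₃)) a₁-low
        ...   | x , x∉₀ | y , y∉₁ , e₁ | w , w∉₁ , e₂ | z , z∉₃ , e₃ =
                HighEnd.impossible x∉₀ (singleMissing a₀-high x∉₀) y∉₁ e₁ w∉₁ e₂ z∉₃ e₃

  impossible : NoThreeDistinct (suc (suc m)) ⊎ PathStart (suc (suc m)) → ⊥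
  impossible shape with argmin sz
  ... | i₀ , γ-min with path-neighbour i₀
  ...   | j₀ , i₀j₀ with minimum-neighbour γ-min i₀j₀
  ...     | x₀ , x₀∉S₀ , fj₀ = cases (any? (λ y → ¬? (y ∈? S₀) ×-dec ¬? (y ≟ x₀)))
    where
      open FromMinimum γ-min i₀j₀ x₀∉S₀ fj₀

      cases : Dec (∃ λ y → y ∉ S₀ × y ≢ x₀) → ⊥
      cases (yes (y₀ , y₀∉S₀ , y₀≢x₀)) = [ short , LongPath.long ] shape
        where open TwoMissing y₀∉S₀ y₀≢x₀
      cases (no none) = [ short , long ] shape
        where
          only : ∀ x → x ∉ S₀ → x ≡ x₀
          only x x∉S₀ = decidable-stable (x ≟ x₀) (λ x≢x₀ → none (x , x∉S₀ , x≢x₀))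
          open OneMissing only

proposition4p5 : (m : ℕ) → 1 ≤ m → m ≢ 1 → m ≢ 3 →
    (n : ℕ) (G : Graph n) → NoIsolated G → NoK2Component G →
    (k : ℕ) → 1 ≤ k → ¬ DktIsoPath G k m
proposition4p5 zero () _ _ _ _ _ _ _ _
proposition4p5 1 _ m≢1 _ _ _ _ _ _ _ _ = m≢1 refl
proposition4p5 2 _ _ _ _ _ noIso noK2 _ _ iso =
  PathIsomorphism.impossible noIso noK2 iso (inj₁ P₂-noThreeDistinct)
proposition4p5 3 _ _ m≢3 _ _ _ _ _ _ _ = m≢3 refl
proposition4p5 (suc (suc (suc (suc m)))) _ _ _ _ _ noIso noK2 _ _ iso =
  PathIsomorphism.impossible noIso noK2 iso (inj₂ (pathStart m))
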